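{- Let $G$ be a finite simple graph, and let $e$ and $e_1$ be two nonadjacent edges of $G$ (no common endpoint). Let $U$ be a minimum edge-cut of $G-V(e)$ and $U_1$ a minimum edge-cut of $G-V(e_1)$. Let $F$ be a fragment of $G-V(e)$ to $U$ and $F_1$ a fragment of $G-V(e_1)$ to $U_1$, and put $F'=G-V(e)-V(F)$ and $F_1'=G-V(e_1)-V(F_1)$. Assume that $e\in E(F_1)$, $e_1\in E(F')$ and $V(F)\cap V(F_1)\neq\emptyset$. Then: ($\alpha$) if $V(F')\cap V(F_1')\neq\emptyset$, then $G[V(F)\cap V(F_1)]$ is a fragment of $G-V(e)$, i.e. the set of edges of $G-V(e)$ joining $V(F)\cap V(F_1)$ to its complement in $V(G)\setminus V(e)$ is a minimum edge-cut of $G-V(e)$; ($\beta$) if $V(F')\cap V(F_1')=\emptyset$, then $|V(F')|<|V(F_1)|$.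
   Context: Graphs are finite, undirected, simple. $V(e)$ denotes the set of the two endpoints of an edge $e$; for $S\subseteq V(G)$, $G-S$ is the subgraph induced by $V(G)\setminus S$, and $G[S]$ is the induced subgraph on $S$. An edge-cut of a graph $H$ is a set $U$ of edges with $H-U$ disconnected; a minimum edge-cut is one of minimum size $\kappa'(H)$. If $U$ is a minimum edge-cut of $H$, a fragment of $H$ to $U$ is an induced subgraph $F=H[S]$ on a nonempty proper subset $S\subsetneq V(H)$ which is a union of components of $H-U$ (equivalently, $U$ is exactly the set of edges of $H$ between $S$ and $V(H)\setminus S$); then $H-V(F)$ is the complementary fragment. $e\in E(F)$ means $e$ is an edge of the subgraph $F$. -}

module Defs where

open import Data.Nat using (ℕ; _≤_; _<_; _+_)
open import Data.Bool using (Bool; true; false; _∧_; _xor_; if_then_else_)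
open import Data.Fin using (Fin; toℕ)
open import Data.Fin.Subset using (Subset; _∈_; _∉_; _⊂_; Nonempty; ∁; ⁅_⁆; _∪_; _─_)
open import Data.Vec using (lookup)
open import Data.List using (map; allFin)
open import Data.Nat.ListAction using (sum)
open import Data.Nat using (_<ᵇ_)
open import Data.Product using (_×_; ∃; ∃-syntax; Σ)
open import Data.Sum using (_⊎_)
open import Relation.Nullary using (¬_)
open import Relation.Binary.PropositionalEquality using (_≡_)

record Graph (n : ℕ) : Set where
  field
    adj    : Fin n → Fin n → Bool
    sym    : ∀ u v → adj u v ≡ adj v u
    irrefl : ∀ u → adj u u ≡ false
open Graph public

-- A set of edges (unordered pairs) is encoded by a Boolean relation;
-- the edge {u,v} belongs to U iff U u v ≡ true.  Symmetry is required
-- where edge sets are quantified over (see IsEdgeSetOf).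
EdgeSet : ℕ → Set
EdgeSet n = Fin n → Fin n → Bool

esize : ∀ {n} → EdgeSet n → ℕ
esize {n} U =
  sum (map (λ i → sum (map (λ j → if U i j ∧ (toℕ i <ᵇ toℕ j) then 1 else 0)
                              (allFin n)))
           (allFin n))

IsEdgeSetOf : ∀ {n} → Graph n → Subset n → EdgeSet n → Set
IsEdgeSetOf G W U =
  (∀ u v → U u v ≡ U v u) ×
  (∀ u v → U u v ≡ true → (adj G u v ≡ true) × (u ∈ W) × (v ∈ W))

data Reach {n} (G : Graph n) (W : Subset n) (U : EdgeSet n) : Fin n → Fin n → Set where
  here : ∀ {u} → u ∈ W → Reach G W U u u
  step : ∀ {u v w} → u ∈ W → v ∈ W → adj G u v ≡ true → U u v ≡ false →
         Reach G W U v w → Reach G W U u w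

Disconnected : ∀ {n} → Graph n → Subset n → EdgeSet n → Set
Disconnected G W U = ∃[ u ] ∃[ v ] (u ∈ W × v ∈ W × ¬ Reach G W U u v)

IsEdgeCut : ∀ {n} → Graph n → Subset n → EdgeSet n → Set
IsEdgeCut G W U = IsEdgeSetOf G W U × Disconnected G W U

IsMinEdgeCut : ∀ {n} → Graph n → Subset n → EdgeSet n → Set
IsMinEdgeCut G W U =
  IsEdgeCut G W U × (∀ U′ → IsEdgeCut G W U′ → esize U ≤ esize U′)

boundary : ∀ {n} → Graph n → Subset n → Subset n → EdgeSet n
boundary G W S u v =
  adj G u v ∧ lookup W u ∧ lookup W v ∧ (lookup S u xor lookup S v)

IsFragment : ∀ {n} → Graph n → Subset n → EdgeSet n → Subset n → Set
IsFragment G W U S =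
  Nonempty S × S ⊂ W × (∀ u v → U u v ≡ boundary G W S u v)

minusEdge : ∀ {n} → Fin n → Fin n → Subset n
minusEdge a b = ∁ (⁅ a ⁆ ∪ ⁅ b ⁆)

-- Write D = F′ ∩ F₁′ and compare, edge by edge, the boundary of F ∩ F₁ in G − V(e)
-- and of D in G − V(e₁) with the boundaries U of F and U₁ of F₁.  Because V(e) ⊆ F₁
-- and V(e₁) ⊆ F′, no edge counts more often on the first side, which gives the
-- submodularity  |∂(F ∩ F₁)| + |∂D| ≤ |U| + |U₁|.  If D ≠ ∅ then ∂D is an edge-cut of
-- G − V(e₁), so |∂D| ≥ |U₁| and ∂(F ∩ F₁) is a cut of G − V(e) with at most |U| edges.
-- If D = ∅ the same vertex-by-vertex count gives |F′| + |F ∩ F₁| + 2 ≤ |F₁| + 2, and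
-- F ∩ F₁ ≠ ∅.  Both local inequalities are finite truth tables, checked by evaluation.

module Submission where

open import Defs hiding (sym)
open import Data.Nat using (ℕ; _<_)
open import Data.Fin using (Fin)
open import Data.Fin.Subset using (Subset; _∈_; _∩_; _─_; Nonempty; Empty; ∣_∣)
open import Data.Bool using (true)
open import Data.Product using (_×_)
open import Relation.Binary.PropositionalEquality using (_≡_; _≢_)

open import Algebra.Bundles using (CommutativeMonoid)
open import Data.Bool using (Bool; false; _∧_; not; _xor_; if_then_else_; T; T?)
open import Data.Bool.Properties
  using ( T-≡; T-∧; ∧-conicalˡ; ∧-conicalʳ; ∧-identityʳ; ∧-zeroʳ; ∧-commutativeMonoid
        ; not-involutive; xor-comm)
open import Data.Fin using (toℕ)
import Data.Fin as Fin
open import Data.Fin.Subset using (_∉_; _⊆_; ∁; ⁅_⁆; _∪_)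
open import Data.Fin.Subset.Properties
  using ( x∈⁅x⁆; x∈⁅y⁆⇒x≡y; ∣⁅x⁆∣≡1; ∣⊥∣≡0; Empty-unique; p⊆q⇒∣p∣≤∣q∣; p∩q⊆p; p∩q⊆q; p─q⊆p
        ; x∈p∪q⁺; x∈p∪q⁻; x∈∁p⇒x∉p; anySubset?)
open import Data.List using ([]; _∷_; map; allFin; tabulate)
open import Data.List.Properties using (map-cong; map-tabulate)
open import Data.Nat using (suc; _+_; _≤_; _≤ᵇ_; _<ᵇ_; z≤n)
open import Data.Nat.ListAction using (sum)
open import Data.Nat.Properties
  using ( ≤-trans; +-mono-≤; +-monoʳ-≤; +-cancelʳ-≤; +-comm; +-suc; +-identityʳ; m≤m+n
        ; +-commutativeSemigroup; ≤ᵇ⇒≤; module ≤-Reasoning)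
open import Data.Product using (_,_; proj₁; proj₂)
open import Data.Sum using (inj₁; inj₂)
open import Data.Vec using (Vec; []; _∷_; lookup)
open import Data.Vec.Properties using (lookup-map; lookup-zipWith; []=⇒lookup; lookup⇒[]=)
open import Function.Base using (_∘_; flip)
open import Function.Bundles using (Equivalence)
open import Relation.Nullary.Decidable using (False; ¬?; toWitnessFalse; decidable-stable)
open import Relation.Binary.PropositionalEquality
  using (refl; sym; trans; cong; cong₂; subst; subst₂; module ≡-Reasoning)
open import Algebra.Properties.CommutativeSemigroup
  (CommutativeMonoid.commutativeSemigroup ∧-commutativeMonoid) using (x∙yz≈y∙xz)
open import Algebra.Properties.CommutativeSemigroup +-commutativeSemigroup
  using () renaming (interchange to +-interchange)

open Equivalence using (to; from)

𝟙 : Bool → ℕ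
𝟙 b = if b then 1 else 0

infixr 1 _⇒_
_⇒_ : Bool → Bool → Bool
true  ⇒ q = q
false ⇒ _ = true

⇒-intro : ∀ {p q} → (T p → T q) → T (p ⇒ q)
⇒-intro {true}  f = f _
⇒-intro {false} _ = _

⇒-elim : ∀ {p q} → T (p ⇒ q) → T p → T q
⇒-elim {true} q _ = q

-- The implicit argument normalises to ⊤ exactly when f has no counterexample, so it is
-- discharged by evaluating f on all 2ᵏ inputs.
decide : ∀ {k} (f : Vec Bool k → Bool) →
         {False (anySubset? (λ v → ¬? (T? (f v))))} → ∀ v → T (f v)
decide f {none} v = decidable-stable (T? (f v)) (λ ¬fv → toWitnessFalse none (v , ¬fv))

𝟙-∧-mono : ∀ c {x y z t} → 𝟙 x + 𝟙 y ≤ 𝟙 z + 𝟙 t →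
           𝟙 (x ∧ c) + 𝟙 (y ∧ c) ≤ 𝟙 (z ∧ c) + 𝟙 (t ∧ c)
𝟙-∧-mono false {x} {y} _ rewrite ∧-zeroʳ x | ∧-zeroʳ y = z≤n
𝟙-∧-mono true {x} {y} {z} {t} h
  rewrite ∧-identityʳ x | ∧-identityʳ y | ∧-identityʳ z | ∧-identityʳ t = h

sum-map-+ : ∀ {A : Set} (f g : A → ℕ) xs →
            sum (map (λ x → f x + g x) xs) ≡ sum (map f xs) + sum (map g xs)
sum-map-+ f g []       = refl
sum-map-+ f g (x ∷ xs) = begin
  f x + g x + sum (map (λ x → f x + g x) xs)    ≡⟨ cong (f x + g x +_) (sum-map-+ f g xs) ⟩
  f x + g x + (sum (map f xs) + sum (map g xs)) ≡⟨ +-interchange (f x) (g x) _ _ ⟩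
  f x + sum (map f xs) + (g x + sum (map g xs)) ∎
  where open ≡-Reasoning

sum-map-mono : ∀ {A : Set} {f g : A → ℕ} xs → (∀ x → f x ≤ g x) →
               sum (map f xs) ≤ sum (map g xs)
sum-map-mono []       _ = z≤n
sum-map-mono (x ∷ xs) h = +-mono-≤ (h x) (sum-map-mono xs h)

sum-map-+-mono : ∀ {A : Set} {f g h k : A → ℕ} xs → (∀ x → f x + g x ≤ h x + k x) →
                 sum (map f xs) + sum (map g xs) ≤ sum (map h xs) + sum (map k xs)
sum-map-+-mono {f = f} {g} {h} {k} xs le =
  subst₂ _≤_ (sum-map-+ f g xs) (sum-map-+ h k xs) (sum-map-mono xs le)

module _ {n : ℕ} {x : Fin n} {p : Subset n} where

  ∈⇒T : x ∈ p → T (lookup p x)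
  ∈⇒T x∈p = from T-≡ ([]=⇒lookup x∈p)

  T⇒∈ : T (lookup p x) → x ∈ p
  T⇒∈ t = lookup⇒[]= x p (to T-≡ t)

  ∉⇒T-not : x ∉ p → T (not (lookup p x))
  ∉⇒T-not x∉p with lookup p x in eq
  ... | true  = x∉p (lookup⇒[]= x p eq)
  ... | false = _

lookup-∩ : ∀ {n} (p q : Subset n) x → lookup (p ∩ q) x ≡ lookup p x ∧ lookup q x
lookup-∩ p q x = lookup-zipWith _∧_ x p q

lookup-∁ : ∀ {n} (p : Subset n) x → lookup (∁ p) x ≡ not (lookup p x)
lookup-∁ p x = lookup-map x not p

lookup-─ : ∀ {n} (p q : Subset n) x → lookup (p ─ q) x ≡ lookup p x ∧ not (lookup q x)
lookup-─ (s ∷ p) (true  ∷ q) Fin.zero    = sym (∧-zeroʳ s)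
lookup-─ (s ∷ p) (false ∷ q) Fin.zero    = sym (∧-identityʳ s)
lookup-─ (_ ∷ p) (_     ∷ q) (Fin.suc x) = lookup-─ p q x

x∈p─q⇒x∉q : ∀ {n} {p q : Subset n} {x} → x ∈ p ─ q → x ∉ q
x∈p─q⇒x∉q {p = p} {q} {x} x∈p─q x∈q = proj₂ (to T-∧ (subst T
  (trans (lookup-─ p q x) (cong (λ b → lookup p x ∧ not b) ([]=⇒lookup x∈q))) (∈⇒T x∈p─q)))

∁-involutive : ∀ {n} (p : Subset n) → ∁ (∁ p) ≡ p
∁-involutive []      = refl
∁-involutive (s ∷ p) = cong₂ _∷_ (not-involutive s) (∁-involutive p)

∣p∪q∣+∣p∩q∣≡∣p∣+∣q∣ : ∀ {n} (p q : Subset n) → ∣ p ∪ q ∣ + ∣ p ∩ q ∣ ≡ ∣ p ∣ + ∣ q ∣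
∣p∪q∣+∣p∩q∣≡∣p∣+∣q∣ []          []          = refl
∣p∪q∣+∣p∩q∣≡∣p∣+∣q∣ (true  ∷ p) (true  ∷ q) = cong suc (begin
  ∣ p ∪ q ∣ + suc ∣ p ∩ q ∣ ≡⟨ +-suc ∣ p ∪ q ∣ _ ⟩
  suc (∣ p ∪ q ∣ + ∣ p ∩ q ∣) ≡⟨ cong suc (∣p∪q∣+∣p∩q∣≡∣p∣+∣q∣ p q) ⟩
  suc (∣ p ∣ + ∣ q ∣)         ≡⟨ +-suc ∣ p ∣ ∣ q ∣ ⟨
  ∣ p ∣ + suc ∣ q ∣           ∎)
  where open ≡-Reasoning
∣p∪q∣+∣p∩q∣≡∣p∣+∣q∣ (true  ∷ p) (false ∷ q) = cong suc (∣p∪q∣+∣p∩q∣≡∣p∣+∣q∣ p q)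
∣p∪q∣+∣p∩q∣≡∣p∣+∣q∣ (false ∷ p) (true  ∷ q) =
  trans (cong suc (∣p∪q∣+∣p∩q∣≡∣p∣+∣q∣ p q)) (sym (+-suc ∣ p ∣ ∣ q ∣))
∣p∪q∣+∣p∩q∣≡∣p∣+∣q∣ (false ∷ p) (false ∷ q) = ∣p∪q∣+∣p∩q∣≡∣p∣+∣q∣ p q

∣⁅x⁆∪⁅y⁆∣≤2 : ∀ {n} (x y : Fin n) → ∣ ⁅ x ⁆ ∪ ⁅ y ⁆ ∣ ≤ 2
∣⁅x⁆∪⁅y⁆∣≤2 x y = begin
  ∣ ⁅ x ⁆ ∪ ⁅ y ⁆ ∣                         ≤⟨ m≤m+n _ _ ⟩
  ∣ ⁅ x ⁆ ∪ ⁅ y ⁆ ∣ + ∣ ⁅ x ⁆ ∩ ⁅ y ⁆ ∣ ≡⟨ ∣p∪q∣+∣p∩q∣≡∣p∣+∣q∣ ⁅ x ⁆ ⁅ y ⁆ ⟩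
  ∣ ⁅ x ⁆ ∣ + ∣ ⁅ y ⁆ ∣                   ≡⟨ cong₂ _+_ (∣⁅x⁆∣≡1 x) (∣⁅x⁆∣≡1 y) ⟩
  2                                       ∎
  where open ≤-Reasoning

x≢y⇒∣⁅x⁆∪⁅y⁆∣≡2 : ∀ {n} {x y : Fin n} → x ≢ y → ∣ ⁅ x ⁆ ∪ ⁅ y ⁆ ∣ ≡ 2
x≢y⇒∣⁅x⁆∪⁅y⁆∣≡2 {n} {x} {y} x≢y = begin
  ∣ ⁅ x ⁆ ∪ ⁅ y ⁆ ∣                         ≡⟨ +-identityʳ _ ⟨
  ∣ ⁅ x ⁆ ∪ ⁅ y ⁆ ∣ + 0                     ≡⟨ cong (∣ ⁅ x ⁆ ∪ ⁅ y ⁆ ∣ +_) ∣⁅x⁆∩⁅y⁆∣≡0 ⟨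
  ∣ ⁅ x ⁆ ∪ ⁅ y ⁆ ∣ + ∣ ⁅ x ⁆ ∩ ⁅ y ⁆ ∣ ≡⟨ ∣p∪q∣+∣p∩q∣≡∣p∣+∣q∣ ⁅ x ⁆ ⁅ y ⁆ ⟩
  ∣ ⁅ x ⁆ ∣ + ∣ ⁅ y ⁆ ∣                   ≡⟨ cong₂ _+_ (∣⁅x⁆∣≡1 x) (∣⁅x⁆∣≡1 y) ⟩
  2                                       ∎
  where
  open ≡-Reasoning
  ∣⁅x⁆∩⁅y⁆∣≡0 : ∣ ⁅ x ⁆ ∩ ⁅ y ⁆ ∣ ≡ 0
  ∣⁅x⁆∩⁅y⁆∣≡0 = trans (cong ∣_∣ (Empty-unique {p = ⁅ x ⁆ ∩ ⁅ y ⁆} λ (z , z∈) → x≢y (trans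
      (sym (x∈⁅y⁆⇒x≡y x (p∩q⊆p ⁅ x ⁆ ⁅ y ⁆ z∈))) (x∈⁅y⁆⇒x≡y y (p∩q⊆q ⁅ x ⁆ ⁅ y ⁆ z∈)))))
    (∣⊥∣≡0 n)

Nonempty⇒0<∣p∣ : ∀ {n} {p : Subset n} → Nonempty p → 0 < ∣ p ∣
Nonempty⇒0<∣p∣ {p = p} (x , x∈p) =
  subst (_≤ ∣ p ∣) (∣⁅x⁆∣≡1 x) (p⊆q⇒∣p∣≤∣q∣ λ y∈⁅x⁆ → subst (_∈ p) (sym (x∈⁅y⁆⇒x≡y x y∈⁅x⁆)) x∈p)

∣p∣≡sum𝟙 : ∀ {n} (p : Subset n) → ∣ p ∣ ≡ sum (map (λ x → 𝟙 (lookup p x)) (allFin n))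
∣p∣≡sum𝟙 {n} p = trans (count p) (cong sum (sym (map-tabulate (λ x → x) (λ x → 𝟙 (lookup p x)))))
  where
  count : ∀ {n} (p : Subset n) → ∣ p ∣ ≡ sum (tabulate (λ x → 𝟙 (lookup p x)))
  count []          = refl
  count (true  ∷ p) = cong suc (count p)
  count (false ∷ p) = count p

esize-cong : ∀ {n} {X Y : EdgeSet n} → (∀ u v → X u v ≡ Y u v) → esize X ≡ esize Y
esize-cong {n} X≡Y = cong sum (flip map-cong (allFin n) λ u →
  cong sum (flip map-cong (allFin n) λ v → cong (λ b → 𝟙 (b ∧ (toℕ u <ᵇ toℕ v))) (X≡Y u v)))

esize-+-mono : ∀ {n} {X Y Z V : EdgeSet n} →
  (∀ u v → 𝟙 (X u v) + 𝟙 (Y u v) ≤ 𝟙 (Z u v) + 𝟙 (V u v)) →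
  esize X + esize Y ≤ esize Z + esize V
esize-+-mono {n} {X} {Y} {Z} {V} le =
  sum-map-+-mono (allFin n) λ u → sum-map-+-mono (allFin n) λ v →
  𝟙-∧-mono (toℕ u <ᵇ toℕ v) {X u v} {Y u v} {Z u v} {V u v} (le u v)

module _ {n} (G : Graph n) (W X : Subset n) where

  boundary-sym : ∀ u v → boundary G W X u v ≡ boundary G W X v u
  boundary-sym u v = cong₂ _∧_ (Graph.sym G u v) (trans
    (x∙yz≈y∙xz (lookup W u) (lookup W v) _)
    (cong (λ b → lookup W v ∧ lookup W u ∧ b) (xor-comm (lookup X u) (lookup X v))))

  boundary-edge : ∀ u v → boundary G W X u v ≡ true → (adj G u v ≡ true) × (u ∈ W) × (v ∈ W)
  boundary-edge u v uv∈ =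
    ∧-conicalˡ _ _ uv∈ ,
    lookup⇒[]= u W (∧-conicalˡ _ _ in-W) ,
    lookup⇒[]= v W (∧-conicalˡ _ _ (∧-conicalʳ (lookup W u) _ in-W))
    where in-W = ∧-conicalʳ (adj G u v) _ uv∈

  boundary-isEdgeSetOf : IsEdgeSetOf G W (boundary G W X)
  boundary-isEdgeSetOf = boundary-sym , boundary-edge

  boundary≡false⇒same-side : ∀ {u v} → u ∈ W → v ∈ W → adj G u v ≡ true →
    boundary G W X u v ≡ false → lookup X u ≡ lookup X v
  boundary≡false⇒same-side u∈W v∈W adj-uv =
    same-side ([]=⇒lookup u∈W) ([]=⇒lookup v∈W) adj-uv
    where
    same-side : ∀ {p q r s t} → q ≡ true → r ≡ true → p ≡ true →
                p ∧ q ∧ r ∧ (s xor t) ≡ false → s ≡ t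
    same-side {s = false} {false} refl refl refl _ = refl
    same-side {s = true}  {true}  refl refl refl _ = refl
    same-side {s = false} {true}  refl refl refl ()
    same-side {s = true}  {false} refl refl refl ()

  reach-boundary : ∀ {u v} → Reach G W (boundary G W X) u v → u ∈ X → v ∈ X
  reach-boundary (here _) u∈X = u∈X
  reach-boundary (step {u} {v} u∈W v∈W adj-uv uv∉ r) u∈X = reach-boundary r
    (lookup⇒[]= v X (trans (sym (boundary≡false⇒same-side u∈W v∈W adj-uv uv∉)) ([]=⇒lookup u∈X)))

  boundary-isEdgeCut : ∀ {u v} → u ∈ W → u ∈ X → v ∈ W → v ∉ X → IsEdgeCut G W (boundary G W X)
  boundary-isEdgeCut {u} {v} u∈W u∈X v∈W v∉X =
    boundary-isEdgeSetOf , u , v , u∈W , v∈W , λ r → v∉X (reach-boundary r u∈X)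

isMinEdgeCut-≤ : ∀ {n} {G : Graph n} {W U U′} → IsMinEdgeCut G W U → IsEdgeCut G W U′ →
                 esize U′ ≤ esize U → IsMinEdgeCut G W U′
isMinEdgeCut-≤ (_ , minimal) cut U′≤U = cut , λ U″ cut″ → ≤-trans U′≤U (minimal U″ cut″)

-- With W = V(G) − V(e) and W₁ = V(G) − V(e₁), the last two fields say V(e) ⊆ F₁ and
-- V(e₁) ⊆ F′.
record Crossing {n} (W W₁ S S₁ : Subset n) : Set where
  field
    S⊆W     : S ⊆ W
    S₁⊆W₁   : S₁ ⊆ W₁
    ∁W⊆S₁   : ∁ W ⊆ S₁
    ∁W₁⊆W─S : ∁ W₁ ⊆ W ─ S

crossingᵇ : Bool → Bool → Bool → Bool → Bool
crossingᵇ w w₁ s s₁ = (s ⇒ w) ∧ (s₁ ⇒ w₁) ∧ (not w ⇒ s₁) ∧ (not w₁ ⇒ w ∧ not s)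

-- boundary G W X u v is boundaryᵇ (adj G u v) (lookup W u) (lookup W v) (lookup X u) (lookup X v).
boundaryᵇ : Bool → Bool → Bool → Bool → Bool → Bool
boundaryᵇ e w w′ s s′ = e ∧ w ∧ w′ ∧ (s xor s′)

edge-crossingᵇ : Vec Bool 9 → Bool
edge-crossingᵇ (e ∷ w ∷ w₁ ∷ s ∷ s₁ ∷ w′ ∷ w₁′ ∷ s′ ∷ s₁′ ∷ []) =
  crossingᵇ w w₁ s s₁ ∧ crossingᵇ w′ w₁′ s′ s₁′ ⇒
  𝟙 (boundaryᵇ e w w′ (s ∧ s₁) (s′ ∧ s₁′)) +
  𝟙 (boundaryᵇ e w₁ w₁′ ((w ∧ not s) ∧ (w₁ ∧ not s₁)) ((w′ ∧ not s′) ∧ (w₁′ ∧ not s₁′)))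
  ≤ᵇ 𝟙 (boundaryᵇ e w w′ s s′) + 𝟙 (boundaryᵇ e w₁ w₁′ s₁ s₁′)

-- a and d stand for lookups in S ∩ S₁ and (W ─ S) ∩ (W₁ ─ S₁), which equal these
-- conjunctions only propositionally.
edge-crossing-≤ : ∀ e w w₁ s s₁ w′ w₁′ s′ s₁′ {a a′ d d′} →
  T (crossingᵇ w w₁ s s₁) → T (crossingᵇ w′ w₁′ s′ s₁′) →
  a ≡ s ∧ s₁ → a′ ≡ s′ ∧ s₁′ →
  d ≡ (w ∧ not s) ∧ (w₁ ∧ not s₁) → d′ ≡ (w′ ∧ not s′) ∧ (w₁′ ∧ not s₁′) →
  𝟙 (boundaryᵇ e w w′ a a′) + 𝟙 (boundaryᵇ e w₁ w₁′ d d′)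
    ≤ 𝟙 (boundaryᵇ e w w′ s s′) + 𝟙 (boundaryᵇ e w₁ w₁′ s₁ s₁′)
edge-crossing-≤ e w w₁ s s₁ w′ w₁′ s′ s₁′ cu cv refl refl refl refl =
  ≤ᵇ⇒≤ _ _ (⇒-elim (decide edge-crossingᵇ (e ∷ w ∷ w₁ ∷ s ∷ s₁ ∷ w′ ∷ w₁′ ∷ s′ ∷ s₁′ ∷ []))
                   (from T-∧ (cu , cv)))

vertex-crossingᵇ : Vec Bool 4 → Bool
vertex-crossingᵇ (w ∷ w₁ ∷ s ∷ s₁ ∷ []) =
  crossingᵇ w w₁ s s₁ ∧ not ((w ∧ not s) ∧ (w₁ ∧ not s₁)) ⇒
  𝟙 (w ∧ not s) + 𝟙 (s ∧ s₁) + 𝟙 (not w) ≤ᵇ 𝟙 s₁ + 𝟙 (not w₁)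

vertex-crossing-≤ : ∀ w w₁ s s₁ {f a c c₁} →
  T (crossingᵇ w w₁ s s₁) → T (not ((w ∧ not s) ∧ (w₁ ∧ not s₁))) →
  f ≡ w ∧ not s → a ≡ s ∧ s₁ → c ≡ not w → c₁ ≡ not w₁ →
  𝟙 f + 𝟙 a + 𝟙 c ≤ 𝟙 s₁ + 𝟙 c₁
vertex-crossing-≤ w w₁ s s₁ cx x∉ refl refl refl refl =
  ≤ᵇ⇒≤ _ _ (⇒-elim (decide vertex-crossingᵇ (w ∷ w₁ ∷ s ∷ s₁ ∷ [])) (from T-∧ (cx , x∉)))

module _ {n} {W W₁ S S₁ : Subset n} (crossing : Crossing W W₁ S S₁) where
  open Crossing crossing

  crossing⇒crossingᵇ : ∀ x → T (crossingᵇ (lookup W x) (lookup W₁ x) (lookup S x) (lookup S₁ x))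
  crossing⇒crossingᵇ x = from T-∧ (S⇒W , from T-∧ (S₁⇒W₁ , from T-∧ (∁W⇒S₁ , ∁W₁⇒W─S)))
    where
    S⇒W   = ⇒-intro λ t → ∈⇒T (S⊆W (T⇒∈ t))
    S₁⇒W₁ = ⇒-intro λ t → ∈⇒T (S₁⊆W₁ (T⇒∈ t))
    ∁W⇒S₁ = ⇒-intro λ t → ∈⇒T (∁W⊆S₁ (T⇒∈ (subst T (sym (lookup-∁ W x)) t)))
    ∁W₁⇒W─S = ⇒-intro λ t →
      subst T (lookup-─ W S x) (∈⇒T (∁W₁⊆W─S (T⇒∈ (subst T (sym (lookup-∁ W₁ x)) t))))

  lookup-─∩─ : ∀ x → lookup ((W ─ S) ∩ (W₁ ─ S₁)) x ≡
                    (lookup W x ∧ not (lookup S x)) ∧ (lookup W₁ x ∧ not (lookup S₁ x))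
  lookup-─∩─ x =
    trans (lookup-∩ (W ─ S) (W₁ ─ S₁) x) (cong₂ _∧_ (lookup-─ W S x) (lookup-─ W₁ S₁ x))

  crossing-esize-≤ : (G : Graph n) →
    esize (boundary G W (S ∩ S₁)) + esize (boundary G W₁ ((W ─ S) ∩ (W₁ ─ S₁)))
      ≤ esize (boundary G W S) + esize (boundary G W₁ S₁)
  crossing-esize-≤ G = esize-+-mono λ u v →
    edge-crossing-≤ (adj G u v)
      (lookup W u) (lookup W₁ u) (lookup S u) (lookup S₁ u)
      (lookup W v) (lookup W₁ v) (lookup S v) (lookup S₁ v)
      (crossing⇒crossingᵇ u) (crossing⇒crossingᵇ v)
      (lookup-∩ S S₁ u) (lookup-∩ S S₁ v) (lookup-─∩─ u) (lookup-─∩─ v)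

  crossing-∣∣-≤ : Empty ((W ─ S) ∩ (W₁ ─ S₁)) →
    ∣ W ─ S ∣ + ∣ S ∩ S₁ ∣ + ∣ ∁ W ∣ ≤ ∣ S₁ ∣ + ∣ ∁ W₁ ∣
  crossing-∣∣-≤ empty = begin
    ∣ W ─ S ∣ + ∣ S ∩ S₁ ∣ + ∣ ∁ W ∣
      ≡⟨ cong₂ _+_ (cong₂ _+_ (∣p∣≡sum𝟙 (W ─ S)) (∣p∣≡sum𝟙 (S ∩ S₁))) (∣p∣≡sum𝟙 (∁ W)) ⟩
    sum (map (𝟙ₓ (W ─ S)) xs) + sum (map (𝟙ₓ (S ∩ S₁)) xs) + sum (map (𝟙ₓ (∁ W)) xs)
      ≡⟨ cong (_+ sum (map (𝟙ₓ (∁ W)) xs)) (sum-map-+ (𝟙ₓ (W ─ S)) (𝟙ₓ (S ∩ S₁)) xs) ⟨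
    sum (map (λ x → 𝟙ₓ (W ─ S) x + 𝟙ₓ (S ∩ S₁) x) xs) + sum (map (𝟙ₓ (∁ W)) xs)
      ≤⟨ sum-map-+-mono xs (λ x → vertex-crossing-≤
           (lookup W x) (lookup W₁ x) (lookup S x) (lookup S₁ x)
           (crossing⇒crossingᵇ x)
           (subst (T ∘ not) (lookup-─∩─ x) (∉⇒T-not λ x∈ → empty (x , x∈)))
           (lookup-─ W S x) (lookup-∩ S S₁ x) (lookup-∁ W x) (lookup-∁ W₁ x)) ⟩
    sum (map (𝟙ₓ S₁) xs) + sum (map (𝟙ₓ (∁ W₁)) xs)
      ≡⟨ cong₂ _+_ (∣p∣≡sum𝟙 S₁) (∣p∣≡sum𝟙 (∁ W₁)) ⟨
    ∣ S₁ ∣ + ∣ ∁ W₁ ∣ ∎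
    where
    open ≤-Reasoning
    xs = allFin n
    𝟙ₓ : Subset n → Fin n → ℕ
    𝟙ₓ p x = 𝟙 (lookup p x)

  crossing-isMinEdgeCut : ∀ {G : Graph n} {U U₁} →
    IsFragment G W U S → IsFragment G W₁ U₁ S₁ →
    IsMinEdgeCut G W U → IsMinEdgeCut G W₁ U₁ →
    Nonempty (S ∩ S₁) → Nonempty ((W ─ S) ∩ (W₁ ─ S₁)) → Nonempty (∁ W) → Nonempty (∁ W₁) →
    IsMinEdgeCut G W (boundary G W (S ∩ S₁))
  crossing-isMinEdgeCut {G} {U} {U₁} (_ , _ , U≡∂S) (_ , _ , U₁≡∂S₁) minU (_ , minimal₁)
    (z , z∈A) (d , d∈D) (x , x∈∁W) (y , y∈∁W₁) =
    isMinEdgeCut-≤ minU cutA (+-cancelʳ-≤ (esize ∂D) (esize ∂A) (esize U) (begin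
      esize ∂A + esize ∂D
        ≤⟨ crossing-esize-≤ G ⟩
      esize (boundary G W S) + esize (boundary G W₁ S₁)
        ≡⟨ cong₂ _+_ (esize-cong U≡∂S) (esize-cong U₁≡∂S₁) ⟨
      esize U + esize U₁
        ≤⟨ +-monoʳ-≤ (esize U) (minimal₁ ∂D cutD) ⟩
      esize U + esize ∂D ∎))
    where
    open ≤-Reasoning
    D = (W ─ S) ∩ (W₁ ─ S₁)
    ∂A = boundary G W (S ∩ S₁)
    ∂D = boundary G W₁ D
    y∈W─S = ∁W₁⊆W─S y∈∁W₁
    cutA : IsEdgeCut G W ∂A
    cutA = boundary-isEdgeCut G W (S ∩ S₁) (S⊆W (p∩q⊆p S S₁ z∈A)) z∈A (p─q⊆p W S y∈W─S)
             (x∈p─q⇒x∉q y∈W─S ∘ p∩q⊆p S S₁)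
    cutD : IsEdgeCut G W₁ ∂D
    cutD = boundary-isEdgeCut G W₁ D (p─q⊆p W₁ S₁ (p∩q⊆q (W ─ S) (W₁ ─ S₁) d∈D)) d∈D
             (S₁⊆W₁ (∁W⊆S₁ x∈∁W)) (x∈∁p⇒x∉p x∈∁W ∘ p─q⊆p W S ∘ p∩q⊆p (W ─ S) (W₁ ─ S₁))

  crossing-∣W─S∣<∣S₁∣ : Nonempty (S ∩ S₁) → Empty ((W ─ S) ∩ (W₁ ─ S₁)) → ∣ ∁ W₁ ∣ ≤ ∣ ∁ W ∣ →
    ∣ W ─ S ∣ < ∣ S₁ ∣
  crossing-∣W─S∣<∣S₁∣ nonempty empty ∣∁W₁∣≤∣∁W∣ = begin
    suc ∣ W ─ S ∣          ≡⟨ +-comm 1 ∣ W ─ S ∣ ⟩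
    ∣ W ─ S ∣ + 1          ≤⟨ +-monoʳ-≤ ∣ W ─ S ∣ (Nonempty⇒0<∣p∣ nonempty) ⟩
    ∣ W ─ S ∣ + ∣ S ∩ S₁ ∣ ≤⟨ +-cancelʳ-≤ ∣ ∁ W ∣ _ _ (≤-trans (crossing-∣∣-≤ empty)
                                (+-monoʳ-≤ ∣ S₁ ∣ ∣∁W₁∣≤∣∁W∣)) ⟩
    ∣ S₁ ∣                 ∎
    where open ≤-Reasoning

∁-minusEdge : ∀ {n} (a b : Fin n) → ∁ (minusEdge a b) ≡ ⁅ a ⁆ ∪ ⁅ b ⁆
∁-minusEdge a b = ∁-involutive (⁅ a ⁆ ∪ ⁅ b ⁆)

∁-minusEdge⊆ : ∀ {n} {a b : Fin n} {p} → a ∈ p → b ∈ p → ∁ (minusEdge a b) ⊆ p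
∁-minusEdge⊆ {a = a} {b} {p} a∈p b∈p x∈ with x∈p∪q⁻ ⁅ a ⁆ ⁅ b ⁆ (subst (_ ∈_) (∁-minusEdge a b) x∈)
... | inj₁ x∈⁅a⁆ = subst (_∈ p) (sym (x∈⁅y⁆⇒x≡y a x∈⁅a⁆)) a∈p
... | inj₂ x∈⁅b⁆ = subst (_∈ p) (sym (x∈⁅y⁆⇒x≡y b x∈⁅b⁆)) b∈p

a∈∁minusEdge : ∀ {n} (a b : Fin n) → a ∈ ∁ (minusEdge a b)
a∈∁minusEdge a b = subst (a ∈_) (sym (∁-minusEdge a b)) (x∈p∪q⁺ (inj₁ (x∈⁅x⁆ a)))

∣∁minusEdge∣≤ : ∀ {n} (G : Graph n) {a b} (a₁ b₁ : Fin n) → adj G a b ≡ true →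
  ∣ ∁ (minusEdge a₁ b₁) ∣ ≤ ∣ ∁ (minusEdge a b) ∣
∣∁minusEdge∣≤ G {a} {b} a₁ b₁ adj-ab = begin
  ∣ ∁ (minusEdge a₁ b₁) ∣ ≡⟨ cong ∣_∣ (∁-minusEdge a₁ b₁) ⟩
  ∣ ⁅ a₁ ⁆ ∪ ⁅ b₁ ⁆ ∣     ≤⟨ ∣⁅x⁆∪⁅y⁆∣≤2 a₁ b₁ ⟩
  2                       ≡⟨ x≢y⇒∣⁅x⁆∪⁅y⁆∣≡2 a≢b ⟨
  ∣ ⁅ a ⁆ ∪ ⁅ b ⁆ ∣       ≡⟨ cong ∣_∣ (∁-minusEdge a b) ⟨
  ∣ ∁ (minusEdge a b) ∣   ∎
  where
  open ≤-Reasoning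
  a≢b : a ≢ b
  a≢b refl with trans (sym adj-ab) (irrefl G a)
  ... | ()

lemma2p1 : ∀ {n} (G : Graph n) (a b a₁ b₁ : Fin n) →
    adj G a b ≡ true → adj G a₁ b₁ ≡ true →
    a ≢ a₁ → a ≢ b₁ → b ≢ a₁ → b ≢ b₁ →
    (U U₁ : EdgeSet n) →
    IsMinEdgeCut G (minusEdge a b) U → IsMinEdgeCut G (minusEdge a₁ b₁) U₁ →
    (S S₁ : Subset n) →
    IsFragment G (minusEdge a b) U S → IsFragment G (minusEdge a₁ b₁) U₁ S₁ →
    a ∈ S₁ → b ∈ S₁ →
    a₁ ∈ minusEdge a b ─ S → b₁ ∈ minusEdge a b ─ S →
    Nonempty (S ∩ S₁) →
    (Nonempty ((minusEdge a b ─ S) ∩ (minusEdge a₁ b₁ ─ S₁)) →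
       IsMinEdgeCut G (minusEdge a b) (boundary G (minusEdge a b) (S ∩ S₁)))
    × (Empty ((minusEdge a b ─ S) ∩ (minusEdge a₁ b₁ ─ S₁)) →
       ∣ minusEdge a b ─ S ∣ < ∣ S₁ ∣)
lemma2p1 G a b a₁ b₁ adj-ab _ _ _ _ _ U U₁ minU minU₁ S S₁ fragS fragS₁
         a∈S₁ b∈S₁ a₁∈F′ b₁∈F′ S∩S₁≢∅ =
    (λ F′∩F₁′≢∅ → crossing-isMinEdgeCut crossing fragS fragS₁ minU minU₁ S∩S₁≢∅ F′∩F₁′≢∅
                    (a , a∈∁minusEdge a b) (a₁ , a∈∁minusEdge a₁ b₁))
  , (λ F′∩F₁′≡∅ → crossing-∣W─S∣<∣S₁∣ crossing S∩S₁≢∅ F′∩F₁′≡∅ (∣∁minusEdge∣≤ G a₁ b₁ adj-ab))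
  where
  crossing : Crossing (minusEdge a b) (minusEdge a₁ b₁) S S₁
  crossing = record
    { S⊆W     = proj₁ (proj₁ (proj₂ fragS))
    ; S₁⊆W₁   = proj₁ (proj₁ (proj₂ fragS₁))
    ; ∁W⊆S₁   = ∁-minusEdge⊆ a∈S₁ b∈S₁
    ; ∁W₁⊆W─S = ∁-minusEdge⊆ a₁∈F′ b₁∈F′
    }
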